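{- Let $K\ge1$ be an integer and let $p$ be an odd prime with $p\mid K^2+4$. Then the multiplicative order of $2^{ -1}K$ modulo $p$ equals $4$, and $\pi_K(p)=4p$.
   Context: The $K$-Fibonacci sequence is $F_{K,0}=0$, $F_{K,1}=1$, $F_{K,n}=K F_{K,n-1}+F_{K,n-2}$; for an integer $m>1$, $\pi_K(m)$ is the length of its shortest period modulo $m$. Here $2^{ -1}$ denotes the inverse of $2$ modulo $p$. -}

module Defs where

open import Data.Nat using (ℕ; zero; suc; _+_; _*_; _^_; _<_; _%_; NonZero)
open import Relation.Binary.PropositionalEquality using (_≡_)
open import Relation.Nullary using (¬_)
open import Data.Product using (_×_)

kfib : ℕ → ℕ → ℕ
kfib K zero = 0
kfib K (suc zero) = 1
kfib K (suc (suc n)) = K * kfib K (suc n) + kfib K n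

IsPeriodMod : (K m T : ℕ) → .{{_ : NonZero m}} → Set
IsPeriodMod K m T = 0 < T × (∀ n → kfib K (n + T) % m ≡ kfib K n % m)

IsPisanoPeriod : (K m T : ℕ) → .{{_ : NonZero m}} → Set
IsPisanoPeriod K m T =
  IsPeriodMod K m T × (∀ S → IsPeriodMod K m S → T Data.Nat.≤ S)

HasOrderMod : (a m d : ℕ) → .{{_ : NonZero m}} → Set
HasOrderMod a m d =
  0 < d × (a ^ d % m ≡ 1 % m) × (∀ e → 0 < e → e < d → ¬ (a ^ e % m ≡ 1 % m))

{-# OPTIONS --safe #-}
-- Modulo p, 2x ≡ K gives 4(x² + 1) ≡ K² + 4 ≡ 0, so x² ≡ -1 as p is odd: x has order 4, and the
-- characteristic polynomial t² - Kt - 1 ≡ (t - x)² has the double root x. Hence F n ≡ n x^(n-1),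
-- which visibly has period 4p. Conversely, a period T gives F T ≡ 0 and F (T + 1) ≡ 1, that is
-- T x^T ≡ 0 and (T + 1) x^T ≡ 1; as x is a unit, p ∣ T and x^T ≡ 1, so 4 ∣ T, and 4p ∣ T.
module Submission where

open import Defs
open import Data.Nat using (ℕ; zero; suc; _+_; _*_; _^_; _<_; _≤_; _%_; _/_; NonZero; z<s; s<s; >-nonZero; >-nonZero⁻¹; nonTrivial⇒n>1)
open import Data.Nat.Properties
open import Data.Nat.DivMod using (%-distribˡ-+; %-distribˡ-*; m≡m%n+[m/n]*n; m%n<n)
open import Data.Nat.Divisibility
  using (_∣_; divides; ∣1⇒≡1; n∣m*n; *-monoʳ-∣; ∣⇒≤; n∣m⇒m%n≡0; m%n≡0⇒n∣m)
open import Data.Nat.Primality using (Prime; euclidsLemma; prime⇒nonTrivial; irreducible[2]; ¬prime[1])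
open import Data.Nat.Tactic.RingSolver using (solve-∀)
open import Data.Product using (_×_; _,_)
open import Data.Sum using (inj₁; inj₂)
open import Function using (_∘_)
open import Relation.Binary.PropositionalEquality as ≡ using (_≡_; _≢_; refl; sym; trans; cong; cong₂; subst)
open import Relation.Binary.Bundles using (Setoid)
import Relation.Binary.Construct.On as On
open import Relation.Nullary using (¬_; contradiction)

odd-prime-∣2*⇒∣ : ∀ {p a} → Prime p → p ≢ 2 → p ∣ 2 * a → p ∣ a
odd-prime-∣2*⇒∣ {p} {a} p-prime p≢2 p∣2a with euclidsLemma 2 a p-prime p∣2a
... | inj₂ p∣a = p∣a
... | inj₁ p∣2 with irreducible[2] p∣2
...   | inj₁ refl = contradiction p-prime ¬prime[1]
...   | inj₂ p≡2  = contradiction p≡2 p≢2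

module Modulo (m : ℕ) .{{_ : NonZero m}} where

  infix 4 _≈_
  _≈_ : ℕ → ℕ → Set
  a ≈ b = a % m ≡ b % m

  setoid : Setoid _ _
  setoid = On.setoid (≡.setoid ℕ) (_% m)

  +-cong : ∀ {a b c d} → a ≈ b → c ≈ d → a + c ≈ b + d
  +-cong {a} {b} {c} {d} a≈b c≈d = begin
    (a + c) % m           ≡⟨ %-distribˡ-+ a c m ⟩
    (a % m + c % m) % m   ≡⟨ cong₂ (λ u v → (u + v) % m) a≈b c≈d ⟩
    (b % m + d % m) % m   ≡⟨ %-distribˡ-+ b d m ⟨
    (b + d) % m           ∎
    where open ≡.≡-Reasoning

  *-cong : ∀ {a b c d} → a ≈ b → c ≈ d → a * c ≈ b * d
  *-cong {a} {b} {c} {d} a≈b c≈d = begin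
    (a * c) % m           ≡⟨ %-distribˡ-* a c m ⟩
    (a % m * (c % m)) % m ≡⟨ cong₂ (λ u v → (u * v) % m) a≈b c≈d ⟩
    (b % m * (d % m)) % m ≡⟨ %-distribˡ-* b d m ⟨
    (b * d) % m           ∎
    where open ≡.≡-Reasoning

  -- The fixed operand is explicit: unification cannot recover it through _+_ or _*_.
  +-congˡ : ∀ a {b c} → b ≈ c → a + b ≈ a + c
  +-congˡ a = +-cong {a} {a} refl

  +-congʳ : ∀ c {a b} → a ≈ b → a + c ≈ b + c
  +-congʳ c a≈b = +-cong {c = c} {d = c} a≈b refl

  *-congˡ : ∀ a {b c} → b ≈ c → a * b ≈ a * c
  *-congˡ a = *-cong {a} {a} refl

  *-congʳ : ∀ c {a b} → a ≈ b → a * c ≈ b * c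
  *-congʳ c a≈b = *-cong {c = c} {d = c} a≈b refl

  ^-congˡ : ∀ {a b} n → a ≈ b → a ^ n ≈ b ^ n
  ^-congˡ zero    a≈b = refl
  ^-congˡ (suc n) a≈b = *-cong a≈b (^-congˡ n a≈b)

  ≡⇒≈ : ∀ {a b} → a ≡ b → a ≈ b
  ≡⇒≈ = cong (_% m)

  0%m≡0 : 0 % m ≡ 0
  0%m≡0 = n∣m⇒m%n≡0 0 m (divides 0 refl)

  ∣⇒≈0 : ∀ {a} → m ∣ a → a ≈ 0
  ∣⇒≈0 {a} m∣a = trans (n∣m⇒m%n≡0 a m m∣a) (sym 0%m≡0)

  ≈0⇒∣ : ∀ {a} → a ≈ 0 → m ∣ a
  ≈0⇒∣ {a} a≈0 = m%n≡0⇒n∣m a m (trans a≈0 0%m≡0)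

  1≉0 : 1 < m → ¬ 1 ≈ 0
  1≉0 1<m = <⇒≢ 1<m ∘ sym ∘ ∣1⇒≡1 ∘ ≈0⇒∣

  module DoubleRoot
    (1<m : 1 < m) (2*a≈0⇒a≈0 : ∀ {a} → 2 * a ≈ 0 → a ≈ 0)
    (K x : ℕ) (2x≈K : 2 * x ≈ K) (K²+4≈0 : K ^ 2 + 4 ≈ 0)
    where

    open import Relation.Binary.Reasoning.Setoid setoid

    4*a≈0⇒a≈0 : ∀ {a} → 4 * a ≈ 0 → a ≈ 0
    4*a≈0⇒a≈0 {a} 4a≈0 = 2*a≈0⇒a≈0 (2*a≈0⇒a≈0 (trans (≡⇒≈ (sym (*-assoc 2 2 a))) 4a≈0))

    x²+1≈0 : x * x + 1 ≈ 0
    x²+1≈0 = 4*a≈0⇒a≈0 (begin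
      4 * (x * x + 1)     ≡⟨ expand x ⟩
      2 * x * (2 * x) + 4 ≈⟨ +-congʳ 4 (*-cong 2x≈K 2x≈K) ⟩
      K * K + 4           ≡⟨ cong (λ k → K * k + 4) (*-identityʳ K) ⟨
      K ^ 2 + 4           ≈⟨ K²+4≈0 ⟩
      0                   ∎)
      where
      expand : ∀ t → 4 * (t * t + 1) ≡ 2 * t * (2 * t) + 4
      expand = solve-∀

    x⁴≈1 : x ^ 4 ≈ 1
    x⁴≈1 = begin
      x ^ 4                   ≡⟨ +-identityʳ (x ^ 4) ⟨
      x ^ 4 + 0               ≈⟨ +-congˡ (x ^ 4) x²+1≈0 ⟨
      x ^ 4 + (x * x + 1)     ≡⟨ regroup x ⟩
      x * x * (x * x + 1) + 1 ≈⟨ +-congʳ 1 (*-congˡ (x * x) x²+1≈0) ⟩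
      x * x * 0 + 1           ≡⟨ cong (_+ 1) (*-zeroʳ (x * x)) ⟩
      1                       ∎
      where
      -- t ^ 4 unfolded, as the ring solver mishandles _^_
      regroup : ∀ t → t * (t * (t * (t * 1))) + (t * t + 1) ≡ t * t * (t * t + 1) + 1
      regroup = solve-∀

    x^[4*q]≈1 : ∀ q → x ^ (4 * q) ≈ 1
    x^[4*q]≈1 q = begin
      x ^ (4 * q) ≡⟨ ^-*-assoc x 4 q ⟨
      (x ^ 4) ^ q ≈⟨ ^-congˡ q x⁴≈1 ⟩
      1 ^ q       ≡⟨ ^-zeroˡ q ⟩
      1           ∎

    x^[n+4*q]≈x^n : ∀ n q → x ^ (n + 4 * q) ≈ x ^ n
    x^[n+4*q]≈x^n n q = begin
      x ^ (n + 4 * q)     ≡⟨ ^-distribˡ-+-* x n (4 * q) ⟩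
      x ^ n * x ^ (4 * q) ≈⟨ *-congˡ (x ^ n) (x^[4*q]≈1 q) ⟩
      x ^ n * 1           ≡⟨ *-identityʳ (x ^ n) ⟩
      x ^ n               ∎

    x^n≈x^[n%4] : ∀ n → x ^ n ≈ x ^ (n % 4)
    x^n≈x^[n%4] n = begin
      x ^ n                       ≡⟨ cong (x ^_) n≡r+4q ⟩
      x ^ (n % 4 + 4 * (n / 4))   ≈⟨ x^[n+4*q]≈x^n (n % 4) (n / 4) ⟩
      x ^ (n % 4)                 ∎
      where
      n≡r+4q : n ≡ n % 4 + 4 * (n / 4)
      n≡r+4q = trans (m≡m%n+[m/n]*n n 4) (cong (n % 4 +_) (*-comm (n / 4) 4))

    *x^n-cancelʳ : ∀ n {a b} → a * x ^ n ≈ b * x ^ n → a ≈ b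
    *x^n-cancelʳ n {a} {b} axⁿ≈bxⁿ = begin
      a                       ≡⟨ *-identityʳ a ⟨
      a * 1                   ≈⟨ *-congˡ a (x^[4*q]≈1 n) ⟨
      a * x ^ (4 * n)         ≡⟨ split a ⟩
      a * x ^ n * x ^ (3 * n) ≈⟨ *-congʳ (x ^ (3 * n)) axⁿ≈bxⁿ ⟩
      b * x ^ n * x ^ (3 * n) ≡⟨ split b ⟨
      b * x ^ (4 * n)         ≈⟨ *-congˡ b (x^[4*q]≈1 n) ⟩
      b * 1                   ≡⟨ *-identityʳ b ⟩
      b                       ∎
      where
      split : ∀ c → c * x ^ (4 * n) ≡ c * x ^ n * x ^ (3 * n)
      split c = trans (cong (c *_) (^-distribˡ-+-* x n (3 * n))) (sym (*-assoc c _ _))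

    *x-cancelʳ : ∀ {a b} → a * x ≈ b * x → a ≈ b
    *x-cancelʳ {a} {b} ax≈bx = *x^n-cancelʳ 1 (begin
      a * x ^ 1 ≡⟨ cong (a *_) (^-identityʳ x) ⟩
      a * x     ≈⟨ ax≈bx ⟩
      b * x     ≡⟨ cong (b *_) (^-identityʳ x) ⟨
      b * x ^ 1 ∎)

    2≉0 : ¬ 2 ≈ 0
    2≉0 = 1≉0 1<m ∘ 2*a≈0⇒a≈0

    x²≉1 : ¬ x * x ≈ 1
    x²≉1 x²≈1 = 2≉0 (begin
      2         ≈⟨ +-congʳ 1 x²≈1 ⟨
      x * x + 1 ≈⟨ x²+1≈0 ⟩
      0         ∎)

    x≉1 : ¬ x ≈ 1
    x≉1 x≈1 = x²≉1 (*-cong x≈1 x≈1)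

    x^r≈1⇒r≡0 : ∀ {r} → r < 4 → x ^ r ≈ 1 → r ≡ 0
    x^r≈1⇒r≡0 {0} _ _ = refl
    x^r≈1⇒r≡0 {1} _ x¹≈1 = contradiction (trans (≡⇒≈ (sym (^-identityʳ x))) x¹≈1) x≉1
    x^r≈1⇒r≡0 {2} _ x²≈1 = contradiction (trans (≡⇒≈ (cong (x *_) (sym (*-identityʳ x)))) x²≈1) x²≉1
    x^r≈1⇒r≡0 {3} _ x³≈1 = contradiction (begin
      x         ≡⟨ *-identityˡ x ⟨
      1 * x     ≈⟨ *-congʳ x x³≈1 ⟨
      x ^ 3 * x ≡⟨ *-comm (x ^ 3) x ⟩
      x ^ 4     ≈⟨ x⁴≈1 ⟩
      1         ∎) x≉1
    x^r≈1⇒r≡0 {suc (suc (suc (suc _)))} (s<s (s<s (s<s (s<s ())))) _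

    -- F n ≡ n x^(n-1), multiplied by x to avoid n ∸ 1.
    kfib*x≈n*x^n : ∀ n → kfib K n * x ≈ n * x ^ n
    kfib*x≈n*x^n 0 = refl
    kfib*x≈n*x^n 1 = ≡⇒≈ (cong (1 *_) (sym (^-identityʳ x)))
    kfib*x≈n*x^n (suc (suc n)) = begin
      (K * kfib K (suc n) + kfib K n) * x
        ≡⟨ *-distribʳ-+ x (K * kfib K (suc n)) (kfib K n) ⟩
      K * kfib K (suc n) * x + kfib K n * x
        ≡⟨ cong (_+ kfib K n * x) (*-assoc K (kfib K (suc n)) x) ⟩
      K * (kfib K (suc n) * x) + kfib K n * x
        ≈⟨ +-cong (*-cong (sym 2x≈K) (kfib*x≈n*x^n (suc n))) (kfib*x≈n*x^n n) ⟩
      2 * x * (suc n * x ^ suc n) + n * x ^ n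
        ≡⟨ complete-square n x (x ^ n) ⟩
      suc (suc n) * x ^ suc (suc n) + n * x ^ n * (x * x + 1)
        ≈⟨ +-congˡ (suc (suc n) * x ^ suc (suc n)) (*-congˡ (n * x ^ n) x²+1≈0) ⟩
      suc (suc n) * x ^ suc (suc n) + n * x ^ n * 0
        ≡⟨ cong (suc (suc n) * x ^ suc (suc n) +_) (*-zeroʳ (n * x ^ n)) ⟩
      suc (suc n) * x ^ suc (suc n) + 0
        ≡⟨ +-identityʳ _ ⟩
      suc (suc n) * x ^ suc (suc n)
        ∎
      where
      complete-square : ∀ n t y → 2 * t * ((1 + n) * (t * y)) + n * y
                                ≡ (2 + n) * (t * (t * y)) + n * y * (t * t + 1)
      complete-square = solve-∀

    kfib-periodic : ∀ n → kfib K (n + 4 * m) ≈ kfib K n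
    kfib-periodic n = *x-cancelʳ (begin
      kfib K (n + 4 * m) * x            ≈⟨ kfib*x≈n*x^n (n + 4 * m) ⟩
      (n + 4 * m) * x ^ (n + 4 * m)     ≈⟨ *-cong (+-congˡ n (∣⇒≈0 (n∣m*n 4))) (x^[n+4*q]≈x^n n m) ⟩
      (n + 0) * x ^ n                   ≡⟨ cong (_* x ^ n) (+-identityʳ n) ⟩
      n * x ^ n                         ≈⟨ kfib*x≈n*x^n n ⟨
      kfib K n * x                      ∎)

    4m∣period : ∀ {T} → IsPeriodMod K m T → 4 * m ∣ T
    4m∣period {T} (_ , periodic) = subst (4 * m ∣_) (sym T≡4q) (*-monoʳ-∣ 4 (≈0⇒∣ q≈0))
      where
      T≈0 : T ≈ 0
      T≈0 = *x^n-cancelʳ T (begin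
        T * x ^ T    ≈⟨ kfib*x≈n*x^n T ⟨
        kfib K T * x ≈⟨ *-congʳ x (periodic 0) ⟩
        0            ∎)

      x^T≈1 : x ^ T ≈ 1
      x^T≈1 = *x-cancelʳ (begin
        x ^ T * x          ≡⟨ *-comm (x ^ T) x ⟩
        x ^ suc T          ≡⟨ +-identityʳ (x ^ suc T) ⟨
        x ^ suc T + 0      ≈⟨ +-congˡ (x ^ suc T) (*-congʳ (x ^ suc T) T≈0) ⟨
        suc T * x ^ suc T  ≈⟨ kfib*x≈n*x^n (suc T) ⟨
        kfib K (suc T) * x ≈⟨ *-congʳ x (periodic 1) ⟩
        1 * x              ∎)

      T%4≡0 : T % 4 ≡ 0
      T%4≡0 = x^r≈1⇒r≡0 (m%n<n T 4) (trans (sym (x^n≈x^[n%4] T)) x^T≈1)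

      q : ℕ
      q = T / 4

      T≡4q : T ≡ 4 * q
      T≡4q = trans (m≡m%n+[m/n]*n T 4) (trans (cong (_+ q * 4) T%4≡0) (*-comm q 4))

      q≈0 : q ≈ 0
      q≈0 = 4*a≈0⇒a≈0 (trans (≡⇒≈ (sym T≡4q)) T≈0)

    x-hasOrder4 : HasOrderMod x m 4
    x-hasOrder4 = z<s , x⁴≈1 , λ e 0<e e<4 x^e≈1 → <⇒≢ 0<e (sym (x^r≈1⇒r≡0 e<4 x^e≈1))

    kfib-pisano-4m : IsPisanoPeriod K m (4 * m)
    kfib-pisano-4m = (>-nonZero⁻¹ (4 * m) {{m*n≢0 4 m}} , kfib-periodic) , minimal
      where
      minimal : ∀ T → IsPeriodMod K m T → 4 * m ≤ T
      minimal T period@(0<T , _) = ∣⇒≤ {{>-nonZero 0<T}} (4m∣period period)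

theorem2p7 : (K p : ℕ) → 1 ≤ K → Prime p → ¬ (p ≡ 2) → p ∣ K ^ 2 + 4 →
    .{{_ : NonZero p}} →
    -- x represents the inverse of 2 times K modulo p (the unique residue x < p with 2x ≡ K mod p)
    (x : ℕ) → x < p → (2 * x) % p ≡ K % p →
    HasOrderMod x p 4 × IsPisanoPeriod K p (4 * p)
theorem2p7 K p _ p-prime p≢2 p∣K²+4 x _ 2x≈K = x-hasOrder4 , kfib-pisano-4m
  where
  open Modulo p
  open DoubleRoot (nonTrivial⇒n>1 p {{prime⇒nonTrivial p-prime}})
                  (∣⇒≈0 ∘ odd-prime-∣2*⇒∣ p-prime p≢2 ∘ ≈0⇒∣)
                  K x 2x≈K (∣⇒≈0 p∣K²+4)
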